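{- Let $n,g,k$ be integers with $1\leq g\leq \left\lfloor \frac{n-k-2}{2}\right\rfloor$ and $1\leq k\leq n-2g-2$. Let $s(n,k)$ be the minimum number of edges of a connected graph $G$ of order $n$ with $\kappa_g(G)=k$. Then $$s(n,k)=n-1.$$
   Context: A set $S$ of vertices is a cutset if $G-S$ is disconnected; for a non-negative integer $g$, a cutset is an $R_g$-cutset if every component of $G-S$ has at least $g+1$ vertices. If $G$ has an $R_g$-cutset, $\kappa_g(G)$ (the $g$-extra connectivity) is the minimum cardinality of an $R_g$-cutset of $G$. -}

module Defs where

open import Data.Nat using (ℕ; zero; suc; _+_; _≤_; _<ᵇ_)
open import Data.Bool using (Bool; true; false; _∧_; if_then_else_)
open import Data.Fin using (Fin; toℕ)
open import Data.Fin.Subset using (Subset; _∈_; _∉_; ⊥; ∣_∣)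
open import Data.List using (List; length; map; allFin)
open import Data.Nat.ListAction using (sum)
open import Data.List.Relation.Unary.All using (All)
open import Data.List.Relation.Unary.Unique.Propositional using (Unique)
open import Data.Product using (Σ; ∃; _×_; _,_)
open import Relation.Binary.PropositionalEquality using (_≡_)
open import Relation.Nullary using (¬_)

record Graph (n : ℕ) : Set where
  field
    adj    : Fin n → Fin n → Bool
    sym    : ∀ i j → adj i j ≡ adj j i
    irrefl : ∀ i → adj i i ≡ false
open Graph public

edgeCount : ∀ {n} → Graph n → ℕ
edgeCount {n} G =
  sum (map (λ i → sum (map (λ j → if adj G i j ∧ (toℕ i <ᵇ toℕ j) then 1 else 0)
                           (allFin n)))
           (allFin n))

data Reach {n : ℕ} (G : Graph n) (S : Subset n) (u : Fin n) : Fin n → Set where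
  here : u ∉ S → Reach G S u u
  step : ∀ {v w} → Reach G S u v → adj G v w ≡ true → w ∉ S → Reach G S u w

Connected : ∀ {n} → Graph n → Set
Connected {n} G = ∀ (u v : Fin n) → Reach G ⊥ u v

IsCutset : ∀ {n} → Graph n → Subset n → Set
IsCutset {n} G S = Σ (Fin n) λ u → Σ (Fin n) λ v → u ∉ S × v ∉ S × ¬ Reach G S u v

-- S is an R_g-cutset: a cutset such that every component of G - S has at least g+1 vertices.
IsRgCutset : ∀ {n} → ℕ → Graph n → Subset n → Set
IsRgCutset {n} g G S =
  IsCutset G S ×
  (∀ (v : Fin n) → v ∉ S →
     Σ (List (Fin n)) λ xs → length xs ≡ suc g × Unique xs × All (Reach G S v) xs)

ExtraConnEq : ∀ {n} → ℕ → Graph n → ℕ → Set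
ExtraConnEq {n} g G k =
  (Σ (Subset n) λ S → IsRgCutset g G S × ∣ S ∣ ≡ k) ×
  (∀ (S : Subset n) → IsRgCutset g G S → k ≤ ∣ S ∣)

-- A connected graph grows from any vertex one vertex at a time along an edge leaving the current
-- vertex set, and each step adds at least one internal edge; so it has at least n − 1 edges.
-- The bound is attained by a tree: a centre with k − 1 pendant vertices and two hubs, the first
-- carrying g pendant vertices and the second the remaining n − k − g − 2 ≥ g of them. Deleting the
-- centre and its pendant vertices leaves the two hub stars, each of order at least g + 1.
-- Conversely, as g ≥ 1, an R_g-cutset isolates no vertex; hence it contains the centre (otherwise
-- every remaining vertex would still reach the centre) and then every pendant vertex of the centre,
-- so it has at least k vertices.

module Submission where

open import Defs
open import Data.Nat using (ℕ; _≤_; _∸_; _*_; _/_)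
open import Data.Product using (Σ; _×_)
open import Relation.Binary.PropositionalEquality using (_≡_)

open import Data.Bool using (Bool; true; false; _∧_; _∨_; if_then_else_)
open import Data.Bool.Properties using (∨-identityʳ; ∨-zeroʳ; ∧-zeroʳ; ∨-comm)
import Data.Bool.Properties as Bool
open import Data.Empty using (⊥-elim)
open import Data.Fin using (Fin; toℕ; fromℕ<) renaming (zero to fzero; suc to fsuc)
open import Data.Fin.Properties using (any?)
import Data.Fin.Properties as Fin
open import Data.Fin.Subset using (Subset; _∈_; _∉_; _⊆_; ∣_∣; inside) renaming (⊥ to ∅)
open import Data.Fin.Subset.Properties using (∉⊥; ∣⊥∣≡0; _∈?_; p⊆q⇒∣p∣≤∣q∣)
open import Data.List using (List; _∷_; length; map; allFin; tabulate)
open import Data.List.Properties using (map-tabulate; length-tabulate)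
open import Data.List.Relation.Unary.All using (All; _∷_)
import Data.List.Relation.Unary.All.Properties as All
open import Data.List.Relation.Unary.AllPairs using (_∷_)
open import Data.List.Relation.Unary.Unique.Propositional using (Unique)
import Data.List.Relation.Unary.Unique.Propositional.Properties as Unique
open import Data.Nat using (zero; suc; _+_; _<_; _<ᵇ_; z≤n; s≤s; _<?_; _≤?_)
import Data.Nat.ListAction as List
open import Data.Nat.Properties
open import Data.Nat.Tactic.RingSolver using (solve-∀)
open import Data.Product using (_,_; ∃; proj₁)
open import Data.Sum using (_⊎_; inj₁; inj₂; [_,_])
open import Data.Vec using ([]; _∷_; here; there)
open import Function using (_∘_)
open import Function.Bundles using (mk⇔)
open import Relation.Binary using (tri<; tri≈; tri>)
open import Relation.Binary.PropositionalEquality as ≡ using (_≢_; refl; cong; cong₂)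
open import Relation.Nullary using (¬_; Dec; yes; no; does; _×-dec_; _⊎-dec_; contradiction)
open import Relation.Nullary.Decidable using (dec-true; dec-false; does-⇔)
open import Algebra.Properties.CommutativeMonoid.Sum +-0-commutativeMonoid
  using (sum-syntax; sum-cong-≗; ∑-distrib-+; ∑-comm; sum-replicate-zero)

ind : Bool → ℕ
ind b = if b then 1 else 0

from-does : ∀ {A : Set} (a? : Dec A) → does a? ≡ true → A
from-does (yes a) _ = a

∑-mono-≤ : ∀ {n} {f g : Fin n → ℕ} → (∀ i → f i ≤ g i) → ∑[ i < n ] f i ≤ ∑[ i < n ] g i
∑-mono-≤ {zero}  f≤g = z≤n
∑-mono-≤ {suc n} f≤g = +-mono-≤ (f≤g fzero) (∑-mono-≤ (f≤g ∘ fsuc))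

∑-mono-< : ∀ {n} {f g : Fin n → ℕ} → (∀ i → f i ≤ g i) → ∀ a → f a < g a →
           ∑[ i < n ] f i < ∑[ i < n ] g i
∑-mono-< f≤g fzero    fa<ga = +-mono-<-≤ fa<ga (∑-mono-≤ (f≤g ∘ fsuc))
∑-mono-< f≤g (fsuc a) fa<ga = +-mono-≤-< (f≤g fzero) (∑-mono-< (f≤g ∘ fsuc) a fa<ga)

∑-one : ∀ n → ∑[ i < n ] 1 ≡ n
∑-one zero    = refl
∑-one (suc n) = cong suc (∑-one n)

∑-ind-≟ : ∀ {n} (w : Fin n) → ∑[ i < n ] ind (does (i Fin.≟ w)) ≡ 1
∑-ind-≟ {suc n} fzero    = cong suc (sum-replicate-zero n)
∑-ind-≟ {suc n} (fsuc w) = ∑-ind-≟ w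

sum-tabulate : ∀ {n} (f : Fin n → ℕ) → List.sum (tabulate f) ≡ ∑[ i < n ] f i
sum-tabulate {zero}  f = refl
sum-tabulate {suc n} f = cong (f fzero +_) (sum-tabulate (f ∘ fsuc))

sum-map-allFin : ∀ {n} (f : Fin n → ℕ) → List.sum (map f (allFin n)) ≡ ∑[ i < n ] f i
sum-map-allFin f = ≡.trans (cong List.sum (map-tabulate (λ i → i) f)) (sum-tabulate f)

module _ {n} (G : Graph n) where

  edge : Fin n → Fin n → Bool
  edge i j = adj G i j ∧ (toℕ i <ᵇ toℕ j)

  edgeCount≡∑∑ : edgeCount G ≡ ∑[ i < n ] ∑[ j < n ] ind (edge i j)
  edgeCount≡∑∑ =
    ≡.trans (sum-map-allFin (λ i → List.sum (map (λ j → ind (edge i j)) (allFin n))))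
            (sum-cong-≗ (λ i → sum-map-allFin (λ j → ind (edge i j))))

module _ {n} {G : Graph n} {X : Subset n} where

  reach-end : ∀ {u v} → Reach G X u v → v ∉ X
  reach-end (here v∉X)     = v∉X
  reach-end (step _ _ v∉X) = v∉X

  reach-trans : ∀ {u v w} → Reach G X u v → Reach G X v w → Reach G X u w
  reach-trans r (here _)        = r
  reach-trans r (step r′ e w∉X) = step (reach-trans r r′) e w∉X

  reach-edge : ∀ {u v} → u ∉ X → adj G u v ≡ true → v ∉ X → Reach G X u v
  reach-edge u∉X e v∉X = step (here u∉X) e v∉X

  reach-sym : ∀ {u v} → Reach G X u v → Reach G X v u
  reach-sym (here u∉X) = here u∉X
  reach-sym {u} (step {v} {w} r e w∉X) =
    reach-trans (reach-edge w∉X (≡.trans (sym G w v) e) (reach-end r)) (reach-sym r)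

  reach-invariant : (P : Fin n → Set) → (∀ {a b} → a ∉ X → P a → adj G a b ≡ true → b ∉ X → P b) →
                    ∀ {u v} → P u → Reach G X u v → P v
  reach-invariant P closed Pu (here _)         = Pu
  reach-invariant P closed Pu (step r e w∉X) = closed (reach-end r) (reach-invariant P closed Pu r) e w∉X

module _ {n} (G : Graph n) where

  internalEdges : (Fin n → Bool) → ℕ
  internalEdges T = ∑[ i < n ] ∑[ j < n ] ind (edge G i j ∧ (T i ∧ T j))

  size : (Fin n → Bool) → ℕ
  size T = ∑[ i < n ] ind (T i)

  insert : Fin n → (Fin n → Bool) → Fin n → Bool
  insert w T z = T z ∨ does (z Fin.≟ w)

  internalEdges≤edgeCount : ∀ T → internalEdges T ≤ edgeCount G
  internalEdges≤edgeCount T rewrite edgeCount≡∑∑ G =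
    ∑-mono-≤ (λ i → ∑-mono-≤ (λ j → ind-∧ (edge G i j) (T i ∧ T j)))
    where
    ind-∧ : ∀ a b → ind (a ∧ b) ≤ ind a
    ind-∧ false b     = z≤n
    ind-∧ true  false = z≤n
    ind-∧ true  true  = ≤-refl

  size-insert : ∀ T w → T w ≡ false → size (insert w T) ≡ suc (size T)
  size-insert T w Tw = begin
    size (insert w T)                    ≡⟨ sum-cong-≗ split ⟩
    ∑[ z < n ] (ind (T z) + [ z ≡w])     ≡⟨ ∑-distrib-+ (ind ∘ T) [_≡w] ⟩
    size T + ∑[ z < n ] [ z ≡w]          ≡⟨ cong (size T +_) (∑-ind-≟ w) ⟩
    size T + 1                           ≡⟨ +-comm (size T) 1 ⟩
    suc (size T)                         ∎
    where
    open ≡.≡-Reasoning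
    [_≡w] : Fin n → ℕ
    [ z ≡w] = ind (does (z Fin.≟ w))
    split : ∀ z → ind (insert w T z) ≡ ind (T z) + [ z ≡w]
    split z with z Fin.≟ w
    ... | yes refl rewrite Tw = refl
    ... | no _     rewrite ∨-identityʳ (T z) = ≡.sym (+-identityʳ _)

  insert-new : ∀ T w → insert w T w ≡ true
  insert-new T w = ≡.trans (cong (T w ∨_) (dec-true (w Fin.≟ w) refl)) (∨-zeroʳ (T w))

  insert-old : ∀ T w {z} → T z ≡ true → insert w T z ≡ true
  insert-old T w {z} Tz = cong (_∨ does (z Fin.≟ w)) Tz

  internalEdges-gain : ∀ T w a b → edge G a b ≡ true → insert w T a ≡ true → insert w T b ≡ true →
                       (T a ∧ T b) ≡ false → internalEdges T < internalEdges (insert w T)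
  internalEdges-gain T w a b ab Ta Tb ¬Tab =
    ∑-mono-< (λ i → ∑-mono-≤ (mono i)) a (∑-mono-< (mono a) b new)
    where
    ind-mono : ∀ e x y x′ y′ → ind (e ∧ (x ∧ y)) ≤ ind (e ∧ ((x ∨ x′) ∧ (y ∨ y′)))
    ind-mono false _     _     _ _ = z≤n
    ind-mono true  false _     _ _ = z≤n
    ind-mono true  true  false _ _ = z≤n
    ind-mono true  true  true  _ _ = ≤-refl
    mono : ∀ i j → ind (edge G i j ∧ (T i ∧ T j)) ≤ ind (edge G i j ∧ (insert w T i ∧ insert w T j))
    mono i j = ind-mono (edge G i j) (T i) (T j) _ _
    new : ind (edge G a b ∧ (T a ∧ T b)) < ind (edge G a b ∧ (insert w T a ∧ insert w T b))
    new rewrite ¬Tab | Ta | Tb | ab = s≤s z≤n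

  internalEdges-insert : ∀ T {u w} → T u ≡ true → T w ≡ false → adj G u w ≡ true →
                         internalEdges T < internalEdges (insert w T)
  internalEdges-insert T {u} {w} Tu Tw u~w with <-cmp (toℕ u) (toℕ w)
  ... | tri< u<w _ _ =
    internalEdges-gain T w u w (cong₂ _∧_ u~w (dec-true (toℕ u <? toℕ w) u<w))
      (insert-old T w Tu) (insert-new T w) (≡.trans (cong (T u ∧_) Tw) (∧-zeroʳ (T u)))
  ... | tri≈ _ u≡w _ =
    contradiction (≡.trans (≡.sym Tu) (≡.trans (cong T (Fin.toℕ-injective u≡w)) Tw)) λ ()
  ... | tri> _ _ w<u =
    internalEdges-gain T w w u (cong₂ _∧_ (≡.trans (sym G w u) u~w) (dec-true (toℕ w <? toℕ u) w<u))
      (insert-new T w) (insert-old T w Tu) (cong (_∧ T u) Tw)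

  crossingEdge : ∀ (T : Fin n → Bool) {u v} → Reach G ∅ u v → T u ≡ true → T v ≡ false →
                 ∃ λ a → ∃ λ b → T a ≡ true × T b ≡ false × adj G a b ≡ true
  crossingEdge T (here _) Tu Tv = contradiction (≡.trans (≡.sym Tu) Tv) λ ()
  crossingEdge T (step {v} r e _) Tu Tw with T v in Tv
  ... | true  = v , _ , Tv , Tw , e
  ... | false = crossingEdge T r Tu Tv

  outsideVertex : ∀ T → size T < n → ∃ λ y → T y ≡ false
  outsideVertex T size<n with any? (λ y → T y Bool.≟ false)
  ... | yes found = found
  ... | no none   = ⊥-elim (<-irrefl (≡.trans (sum-cong-≗ full) (∑-one n)) size<n)
    where
    full : ∀ y → ind (T y) ≡ 1
    full y with T y in Ty
    ... | true  = refl
    ... | false = ⊥-elim (none (y , Ty))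

  growingSet : Connected G → ∀ r m → m < n →
               Σ (Fin n → Bool) λ T → T r ≡ true × size T ≡ suc m × m ≤ internalEdges T
  growingSet conn r zero _ = (λ z → does (z Fin.≟ r)) , dec-true (r Fin.≟ r) refl , ∑-ind-≟ r , z≤n
  growingSet conn r (suc m) 1+m<n with growingSet conn r m (<-trans (n<1+n m) 1+m<n)
  ... | T , Tr , sizeT , m≤E with outsideVertex T (≡.subst (_< n) (≡.sym sizeT) 1+m<n)
  ... | y , Ty with crossingEdge T (conn r y) Tr Ty
  ... | a , b , Ta , Tb , a~b =
    insert b T , insert-old T b Tr , ≡.trans (size-insert T b Tb) (cong suc sizeT) ,
    ≤-trans (s≤s m≤E) (internalEdges-insert T Ta Tb a~b)

connected⇒n∸1≤edgeCount : ∀ {n} (G : Graph n) → Connected G → n ∸ 1 ≤ edgeCount G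
connected⇒n∸1≤edgeCount {zero}  G _    = z≤n
connected⇒n∸1≤edgeCount {suc n} G conn with growingSet G conn fzero n ≤-refl
... | T , _ , _ , n≤E = ≤-trans n≤E (internalEdges≤edgeCount G T)

module _ {n} {G : Graph n} {X : Subset n} where

  reach-from-isolated : ∀ {w z} → (∀ y → adj G w y ≡ true → y ∈ X) → Reach G X w z → z ≡ w
  reach-from-isolated {w} isolated = reach-invariant (_≡ w) stuck refl
    where
    stuck : ∀ {a b} → a ∉ X → a ≡ w → adj G a b ≡ true → b ∉ X → b ≡ w
    stuck _ refl a~b b∉X = ⊥-elim (b∉X (isolated _ a~b))

  Rg-cutset⇒¬isolated : ∀ {g} → 1 ≤ g → IsRgCutset g G X → ∀ {w} → w ∉ X →
                        ¬ (∀ y → adj G w y ≡ true → y ∈ X)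
  Rg-cutset⇒¬isolated (s≤s _) (_ , components) w∉X isolated with components _ w∉X
  ... | a ∷ b ∷ _ , _ , (a≢b ∷ _) ∷ _ , reach-a ∷ reach-b ∷ _ =
    a≢b (≡.trans (reach-from-isolated isolated reach-a) (≡.sym (reach-from-isolated isolated reach-b)))

module _ {n} {G : Graph n} {X : Subset n} {v : Fin n} where

  distinctReachable : ∀ {m} (f : Fin m → Fin n) → (∀ {i j} → f i ≡ f j → i ≡ j) →
                      (∀ i → Reach G X v (f i)) →
                      Σ (List (Fin n)) λ xs → length xs ≡ m × Unique xs × All (Reach G X v) xs
  distinctReachable f f-injective reach =
    tabulate f , length-tabulate f , Unique.tabulate⁺ f-injective , All.tabulate⁺ reach

below : ∀ {n} → ℕ → Subset n
below {zero}  _       = []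
below {suc n} zero    = ∅
below {suc n} (suc k) = inside ∷ below k

∣below∣ : ∀ {n k} → k ≤ n → ∣ below {n} k ∣ ≡ k
∣below∣ {zero}  z≤n       = refl
∣below∣ {suc n} z≤n       = ∣⊥∣≡0 (suc n)
∣below∣ {suc n} (s≤s k≤n) = cong suc (∣below∣ k≤n)

∈below⇒< : ∀ {n k} {x : Fin n} → x ∈ below k → toℕ x < k
∈below⇒< {suc n} {zero}           x∈∅         = ⊥-elim (∉⊥ x∈∅)
∈below⇒< {suc n} {suc k} {fzero}  _           = s≤s z≤n
∈below⇒< {suc n} {suc k} {fsuc x} (there x∈b) = s≤s (∈below⇒< x∈b)

<⇒∈below : ∀ {n k} {x : Fin n} → toℕ x < k → x ∈ below k
<⇒∈below {suc n} {suc k} {fzero}  _       = here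
<⇒∈below {suc n} {suc k} {fsuc x} (s≤s x<k) = there (<⇒∈below x<k)

interval : ∀ {n m} b → b + m ≤ n → Fin m → Fin n
interval b b+m≤n i = fromℕ< (<-≤-trans (+-monoʳ-< b (Fin.toℕ<n i)) b+m≤n)

toℕ-interval : ∀ {n m} b (b+m≤n : b + m ≤ n) i → toℕ (interval b b+m≤n i) ≡ b + toℕ i
toℕ-interval b _ _ = Fin.toℕ-fromℕ< _

interval-range : ∀ {n m} b (b+m≤n : b + suc m ≤ n) i →
                 b ≤ toℕ (interval b b+m≤n i) × toℕ (interval b b+m≤n i) ≤ b + m
interval-range b b+m≤n i rewrite toℕ-interval b b+m≤n i =
  m≤m+n b (toℕ i) , +-monoʳ-≤ b (Fin.toℕ≤pred[n] i)

interval-injective : ∀ {n m} b (b+m≤n : b + m ≤ n) {i j} →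
                     interval b b+m≤n i ≡ interval b b+m≤n j → i ≡ j
interval-injective b b+m≤n {i} {j} eq = Fin.toℕ-injective (+-cancelˡ-≡ b (toℕ i) (toℕ j) (begin
  b + toℕ i                   ≡⟨ toℕ-interval b b+m≤n i ⟨
  toℕ (interval b b+m≤n i)    ≡⟨ cong toℕ eq ⟩
  toℕ (interval b b+m≤n j)    ≡⟨ toℕ-interval b b+m≤n j ⟩
  b + toℕ j                   ∎))
  where open ≡.≡-Reasoning

module ParentTree (par : ℕ → ℕ) (par< : ∀ {x} → 0 < x → par x < x) (n : ℕ) where

  ParentOf : ℕ → ℕ → Set
  ParentOf y x = 0 < x × par x ≡ y

  parentOf? : ∀ y x → Dec (ParentOf y x)
  parentOf? y x = (0 <? x) ×-dec (par x ≟ y)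

  ¬ParentOf-self : ∀ x → ¬ ParentOf x x
  ¬ParentOf-self x (0<x , px≡x) = <-irrefl px≡x (par< 0<x)

  Linked : ℕ → ℕ → Set
  Linked x y = ParentOf x y ⊎ ParentOf y x

  linked? : ∀ x y → Dec (Linked x y)
  linked? x y = parentOf? x y ⊎-dec parentOf? y x

  tree : Graph n
  tree = record
    { adj    = λ i j → does (linked? (toℕ i) (toℕ j))
    ; sym    = λ i j → ∨-comm (does (parentOf? (toℕ i) (toℕ j))) (does (parentOf? (toℕ j) (toℕ i)))
    ; irrefl = λ i → dec-false (linked? (toℕ i) (toℕ i))
                                [ ¬ParentOf-self (toℕ i) , ¬ParentOf-self (toℕ i) ]
    }

  adj⇒linked : ∀ {a b} → adj tree a b ≡ true → Linked (toℕ a) (toℕ b)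
  adj⇒linked {a} {b} = from-does (linked? (toℕ a) (toℕ b))

  ParentOf⇒adj : ∀ {a b} → ParentOf (toℕ a) (toℕ b) → adj tree a b ≡ true
  ParentOf⇒adj {a} {b} p = dec-true (linked? (toℕ a) (toℕ b)) (inj₁ p)

  edge-tree : ∀ i j → edge tree i j ≡ does (parentOf? (toℕ i) (toℕ j))
  edge-tree i j =
    does-⇔ (mk⇔ to from) (linked? (toℕ i) (toℕ j) ×-dec (toℕ i <? toℕ j)) (parentOf? (toℕ i) (toℕ j))
    where
    to : Linked (toℕ i) (toℕ j) × toℕ i < toℕ j → ParentOf (toℕ i) (toℕ j)
    to (inj₁ p , _) = p
    to (inj₂ (0<i , pi≡j) , i<j) = ⊥-elim (<-asym i<j (≡.subst (_< toℕ i) pi≡j (par< 0<i)))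
    from : ParentOf (toℕ i) (toℕ j) → Linked (toℕ i) (toℕ j) × toℕ i < toℕ j
    from p@(0<j , pj≡i) = inj₁ p , ≡.subst (_< toℕ j) pj≡i (par< 0<j)

  ∑-ParentOf : ∀ y → y < n → ∑[ i < n ] ind (does (parentOf? (toℕ i) y)) ≡ ind (does (0 <? y))
  ∑-ParentOf zero    _   = sum-replicate-zero n
  ∑-ParentOf (suc y) y<n = ≡.trans (sum-cong-≗ same) (∑-ind-≟ p)
    where
    p : Fin n
    p = fromℕ< (<-trans (par< (s≤s z≤n)) y<n)
    same : ∀ i → ind (does (par (suc y) ≟ toℕ i)) ≡ ind (does (i Fin.≟ p))
    same i = cong ind (does-⇔ (mk⇔ to from) (par (suc y) ≟ toℕ i) (i Fin.≟ p))
      where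
      to : par (suc y) ≡ toℕ i → i ≡ p
      to e = Fin.toℕ-injective (≡.trans (≡.sym e) (≡.sym (Fin.toℕ-fromℕ< _)))
      from : i ≡ p → par (suc y) ≡ toℕ i
      from refl = ≡.sym (Fin.toℕ-fromℕ< _)

  tree-edgeCount : edgeCount tree ≡ n ∸ 1
  tree-edgeCount = begin
    edgeCount tree                                               ≡⟨ edgeCount≡∑∑ tree ⟩
    ∑[ i < n ] ∑[ j < n ] ind (edge tree i j)    ≡⟨ sum-cong-≗ (λ i → sum-cong-≗ (λ j → cong ind (edge-tree i j))) ⟩
    ∑[ i < n ] ∑[ j < n ] [ i parent j ]         ≡⟨ ∑-comm {n} {n} [_parent_] ⟩
    ∑[ j < n ] ∑[ i < n ] [ i parent j ]         ≡⟨ sum-cong-≗ (λ j → ∑-ParentOf (toℕ j) (Fin.toℕ<n j)) ⟩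
    ∑[ j < n ] ind (does (0 <? toℕ j))           ≡⟨ nonRoots n ⟩
    n ∸ 1                                        ∎
    where
    open ≡.≡-Reasoning
    [_parent_] : Fin n → Fin n → ℕ
    [ i parent j ] = ind (does (parentOf? (toℕ i) (toℕ j)))
    nonRoots : ∀ m → ∑[ j < m ] ind (does (0 <? toℕ j)) ≡ m ∸ 1
    nonRoots zero    = refl
    nonRoots (suc m) = ∑-one m

  parent : (x : Fin n) → 0 < toℕ x → Fin n
  parent x 0<x = fromℕ< (<-trans (par< 0<x) (Fin.toℕ<n x))

  parent-≡ : ∀ x 0<x {d} → par (toℕ x) ≡ toℕ d → parent x 0<x ≡ d
  parent-≡ x 0<x px≡d = Fin.toℕ-injective (≡.trans (Fin.toℕ-fromℕ< _) px≡d)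

  parent-adj : ∀ x 0<x → adj tree x (parent x 0<x) ≡ true
  parent-adj x 0<x = ≡.trans (sym tree x _) (ParentOf⇒adj (0<x , ≡.sym (Fin.toℕ-fromℕ< _)))

  childless-adj : ∀ {w} → (∀ x → ¬ ParentOf (toℕ w) x) → (0<w : 0 < toℕ w) →
                  ∀ {y} → adj tree w y ≡ true → y ≡ parent w 0<w
  childless-adj childless 0<w w~y with adj⇒linked w~y
  ... | inj₁ w-parent-of-y = ⊥-elim (childless _ w-parent-of-y)
  ... | inj₂ (_ , pw≡y)    = ≡.sym (parent-≡ _ 0<w pw≡y)

  module _ {X : Subset n} where

    reach-star : ∀ {h z} → h ∉ X → z ∉ X → toℕ h ≤ toℕ z → (toℕ h < toℕ z → par (toℕ z) ≡ toℕ h) →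
                 Reach tree X h z
    reach-star h∉X z∉X h≤z star with m≤n⇒m<n∨m≡n h≤z
    ... | inj₁ h<z = reach-edge h∉X (ParentOf⇒adj (≤-<-trans z≤n h<z , star h<z)) z∉X
    ... | inj₂ h≡z rewrite Fin.toℕ-injective h≡z = here z∉X

    reach-root : ∀ {r} → toℕ r ≡ 0 → r ∉ X → (∀ w → w ∉ X → (0<w : 0 < toℕ w) → parent w 0<w ∉ X) →
                 ∀ w → w ∉ X → Reach tree X w r
    reach-root {r} r≡0 r∉X parent∉X w = climb (suc (toℕ w)) w ≤-refl
      where
      climb : ∀ m w → toℕ w < m → w ∉ X → Reach tree X w r
      climb (suc m) w (s≤s w≤m) w∉X with toℕ w ≟ 0
      ... | yes w≡0 rewrite Fin.toℕ-injective {i = w} {j = r} (≡.trans w≡0 (≡.sym r≡0)) = here w∉X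
      ... | no w≢0 =
        reach-trans (reach-edge w∉X (parent-adj w 0<w) (parent∉X w w∉X 0<w))
                    (climb m (parent w 0<w) p<m (parent∉X w w∉X 0<w))
        where
        0<w : 0 < toℕ w
        0<w = n≢0⇒n>0 w≢0
        p<m : toℕ (parent w 0<w) < m
        p<m = ≡.subst (_< m) (≡.sym (Fin.toℕ-fromℕ< _)) (<-≤-trans (par< 0<w) w≤m)

  tree-connected : Connected tree
  tree-connected u v = reach-trans (toRoot u) (reach-sym (toRoot v))
    where
    root : Fin n
    root = fromℕ< (≤-<-trans z≤n (Fin.toℕ<n u))
    toRoot : ∀ w → Reach tree ∅ w root
    toRoot w = reach-root (Fin.toℕ-fromℕ< _) ∉⊥ (λ _ _ _ → ∉⊥) w ∉⊥

-- Labels: the centre is 0, its pendant vertices 1 … k − 1, the first hub k with pendant vertices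
-- k + 1 … k + g, and the second hub k₂ with pendant vertices k₂ + 1 … n − 1.
module Extremal (n g k : ℕ) (1≤g : 1 ≤ g) (1≤k : 1 ≤ k) (room : (k + 2) + 2 * g ≤ n) where

  k₂ : ℕ
  k₂ = suc (k + g)

  data Position : ℕ → Set where
    inner : ∀ {x} → x ≤ k → Position x
    arm₁  : ∀ {x} → k < x → x ≤ k + g → Position x
    outer : Position k₂
    arm₂  : ∀ {x} → k₂ < x → Position x

  position : ∀ x → Position x
  position x with x ≤? k
  ... | yes x≤k = inner x≤k
  ... | no x≰k with x ≤? k + g
  ...   | yes x≤k+g = arm₁ (≰⇒> x≰k) x≤k+g
  ...   | no x≰k+g with x ≟ k₂
  ...     | yes refl    = outer
  ...     | no x≢k₂ = arm₂ (≤∧≢⇒< (≰⇒> x≰k+g) (≡.≢-sym x≢k₂))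

  par : ℕ → ℕ
  par x with position x
  ... | inner _  = 0
  ... | arm₁ _ _ = k
  ... | outer    = 0
  ... | arm₂ _   = k₂

  par< : ∀ {x} → 0 < x → par x < x
  par< {x} 0<x with position x
  ... | inner _      = 0<x
  ... | arm₁ k<x _   = k<x
  ... | outer        = 0<x
  ... | arm₂ k₂<x  = k₂<x

  k<k₂ : k < k₂
  k<k₂ = s≤s (m≤m+n k g)

  par-inner : ∀ {x} → x ≤ k → par x ≡ 0
  par-inner {x} x≤k with position x
  ... | inner _      = refl
  ... | arm₁ k<x _   = ⊥-elim (<⇒≱ k<x x≤k)
  ... | outer        = ⊥-elim (<⇒≱ k<k₂ x≤k)
  ... | arm₂ k₂<x  = ⊥-elim (<⇒≱ (<-trans k<k₂ k₂<x) x≤k)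

  par-arm₁ : ∀ {x} → k < x → x ≤ k + g → par x ≡ k
  par-arm₁ {x} k<x x≤k+g with position x
  ... | inner x≤k    = ⊥-elim (<⇒≱ k<x x≤k)
  ... | arm₁ _ _     = refl
  ... | outer        = ⊥-elim (<-irrefl refl (s≤s x≤k+g))
  ... | arm₂ k₂<x  = ⊥-elim (<⇒≱ (<-trans (n<1+n _) k₂<x) x≤k+g)

  par-k₂ : par k₂ ≡ 0
  par-k₂ with position k₂
  ... | inner k₂≤k      = ⊥-elim (<⇒≱ k<k₂ k₂≤k)
  ... | arm₁ _ k₂≤k+g   = ⊥-elim (<-irrefl refl k₂≤k+g)
  ... | outer             = refl
  ... | arm₂ k₂<k₂    = ⊥-elim (<-irrefl refl k₂<k₂)

  par-arm₂ : ∀ {x} → k₂ < x → par x ≡ k₂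
  par-arm₂ {x} k₂<x with position x
  ... | inner x≤k      = ⊥-elim (<⇒≱ (<-trans k<k₂ k₂<x) x≤k)
  ... | arm₁ _ x≤k+g   = ⊥-elim (<⇒≱ (<-trans (n<1+n _) k₂<x) x≤k+g)
  ... | outer          = ⊥-elim (<-irrefl refl k₂<x)
  ... | arm₂ _         = refl

  open ParentTree par par< n public

  childless : ∀ {w} → 0 < w → w ≢ k → w ≢ k₂ → ∀ x → ¬ ParentOf w x
  childless {w} 0<w w≢k w≢k₂ x (_ , px≡w) with position x
  ... | inner _  = <⇒≢ 0<w px≡w
  ... | arm₁ _ _ = w≢k (≡.sym px≡w)
  ... | outer    = <⇒≢ 0<w px≡w
  ... | arm₂ _   = w≢k₂ (≡.sym px≡w)

  branch₁-closed : ∀ {a b} → k ≤ a → a ≤ k + g → k ≤ b → ParentOf a b ⊎ ParentOf b a → b ≤ k + g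
  branch₁-closed {a} {b} k≤a a≤k+g k≤b (inj₁ (_ , pb≡a)) with position b
  ... | inner b≤k      = ≤-trans b≤k (m≤m+n k g)
  ... | arm₁ _ b≤k+g   = b≤k+g
  ... | outer          = ⊥-elim (<⇒≱ 1≤k (≤-trans k≤a (≤-reflexive (≡.sym pb≡a))))
  ... | arm₂ _         = ⊥-elim (<-irrefl refl (≤-trans (≤-reflexive pb≡a) a≤k+g))
  branch₁-closed {a} {b} k≤a a≤k+g k≤b (inj₂ (_ , pa≡b)) with position a
  ... | inner _        = ⊥-elim (<⇒≱ 1≤k (≤-trans k≤b (≤-reflexive (≡.sym pa≡b))))
  ... | arm₁ _ _       = ≤-trans (≤-reflexive (≡.sym pa≡b)) (m≤m+n k g)
  ... | outer          = ⊥-elim (<-irrefl refl (s≤s a≤k+g))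
  ... | arm₂ k₂<a    = ⊥-elim (<⇒≱ (<-trans (n<1+n _) k₂<a) a≤k+g)

  last<n : k₂ + g < n
  last<n = ≡.subst (_≤ n) (arith k g) room
    where
    arith : ∀ k g → (k + 2) + 2 * g ≡ suc (suc (k + g) + g)
    arith = solve-∀

  k₂<n : k₂ < n
  k₂<n = ≤-<-trans (m≤m+n k₂ g) last<n

  centre hub₁ hub₂ : Fin n
  centre = fromℕ< (≤-<-trans z≤n k₂<n)
  hub₁  = fromℕ< (<-trans k<k₂ k₂<n)
  hub₂  = fromℕ< k₂<n

  S₀ : Subset n
  S₀ = below k

  ∉S₀⇒k≤ : ∀ {x} → x ∉ S₀ → k ≤ toℕ x
  ∉S₀⇒k≤ x∉S₀ = ≮⇒≥ (x∉S₀ ∘ <⇒∈below)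

  k≤⇒∉S₀ : ∀ {x} → k ≤ toℕ x → x ∉ S₀
  k≤⇒∉S₀ k≤x x∈S₀ = <⇒≱ (∈below⇒< x∈S₀) k≤x

  toℕ-centre : toℕ centre ≡ 0
  toℕ-centre = Fin.toℕ-fromℕ< _

  toℕ-hub₁ : toℕ hub₁ ≡ k
  toℕ-hub₁ = Fin.toℕ-fromℕ< _

  toℕ-hub₂ : toℕ hub₂ ≡ k₂
  toℕ-hub₂ = Fin.toℕ-fromℕ< _

  hub₁∉S₀ : hub₁ ∉ S₀
  hub₁∉S₀ = k≤⇒∉S₀ (≤-reflexive (≡.sym toℕ-hub₁))

  hub₂∉S₀ : hub₂ ∉ S₀
  hub₂∉S₀ = k≤⇒∉S₀ (≤-trans (<⇒≤ k<k₂) (≤-reflexive (≡.sym toℕ-hub₂)))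

  reach-hub₁ : ∀ {z} → z ∉ S₀ → toℕ z ≤ k + g → Reach tree S₀ hub₁ z
  reach-hub₁ {z} z∉S₀ z≤k+g =
    reach-star hub₁∉S₀ z∉S₀
      (≡.subst (_≤ toℕ z) (≡.sym toℕ-hub₁) (∉S₀⇒k≤ z∉S₀))
      (λ h<z → ≡.trans (par-arm₁ (≡.subst (_< toℕ z) toℕ-hub₁ h<z) z≤k+g) (≡.sym toℕ-hub₁))

  reach-hub₂ : ∀ {z} → k₂ ≤ toℕ z → Reach tree S₀ hub₂ z
  reach-hub₂ {z} k₂≤z =
    reach-star hub₂∉S₀ (k≤⇒∉S₀ (≤-trans (<⇒≤ k<k₂) k₂≤z))
      (≡.subst (_≤ toℕ z) (≡.sym toℕ-hub₂) k₂≤z)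
      (λ h<z → ≡.trans (par-arm₂ (≡.subst (_< toℕ z) toℕ-hub₂ h<z)) (≡.sym toℕ-hub₂))

  S₀-separates : ¬ Reach tree S₀ hub₁ hub₂
  S₀-separates r =
    <-irrefl refl (≡.subst (_≤ k + g) toℕ-hub₂ (reach-invariant (λ z → toℕ z ≤ k + g) closed hub₁≤k+g r))
    where
    hub₁≤k+g : toℕ hub₁ ≤ k + g
    hub₁≤k+g = ≤-trans (≤-reflexive toℕ-hub₁) (m≤m+n k g)
    closed : ∀ {a b} → a ∉ S₀ → toℕ a ≤ k + g → adj tree a b ≡ true → b ∉ S₀ → toℕ b ≤ k + g
    closed a∉S₀ a≤k+g a~b b∉S₀ = branch₁-closed (∉S₀⇒k≤ a∉S₀) a≤k+g (∉S₀⇒k≤ b∉S₀) (adj⇒linked a~b)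

  S₀-components : ∀ v → v ∉ S₀ →
                  Σ (List (Fin n)) λ xs → length xs ≡ suc g × Unique xs × All (Reach tree S₀ v) xs
  S₀-components v v∉S₀ with toℕ v ≤? k + g
  ... | yes v≤k+g = distinctReachable (interval k arm₁≤n) (interval-injective k arm₁≤n) λ i →
    let (k≤z , z≤k+g) = interval-range k arm₁≤n i in
    reach-trans (reach-sym (reach-hub₁ v∉S₀ v≤k+g)) (reach-hub₁ (k≤⇒∉S₀ k≤z) z≤k+g)
    where
    arm₁≤n : k + suc g ≤ n
    arm₁≤n = ≡.subst (_≤ n) (≡.sym (+-suc k g)) (<⇒≤ k₂<n)
  ... | no v≰k+g = distinctReachable (interval k₂ arm₂≤n) (interval-injective k₂ arm₂≤n) λ i →
    reach-trans (reach-sym (reach-hub₂ (≰⇒> v≰k+g))) (reach-hub₂ (proj₁ (interval-range k₂ arm₂≤n i)))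
    where
    arm₂≤n : k₂ + suc g ≤ n
    arm₂≤n = ≡.subst (_≤ n) (≡.sym (+-suc k₂ g)) last<n

  S₀-RgCutset : IsRgCutset g tree S₀
  S₀-RgCutset =
    (hub₁ , hub₂ , hub₁∉S₀ , hub₂∉S₀ , S₀-separates) ,
    S₀-components

  parent≡centre : ∀ w 0<w → par (toℕ w) ≡ 0 → parent w 0<w ≡ centre
  parent≡centre w 0<w pw≡0 = parent-≡ w 0<w (≡.trans pw≡0 (≡.sym toℕ-centre))

  module _ {X : Subset n} (rg : IsRgCutset g tree X) where

    leaf-parent∉ : ∀ w → w ∉ X → (0<w : 0 < toℕ w) → toℕ w ≢ k → toℕ w ≢ k₂ → parent w 0<w ∉ X
    leaf-parent∉ w w∉X 0<w w≢k w≢k₂ p∈X = Rg-cutset⇒¬isolated 1≤g rg w∉X λ y w~y →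
      ≡.subst (_∈ X) (≡.sym (childless-adj (childless 0<w w≢k w≢k₂) 0<w w~y)) p∈X

    reach-centre : centre ∉ X → ∀ w → w ∉ X → Reach tree X w centre
    reach-centre c∉X = reach-root toℕ-centre c∉X parent∉X
      where
      parent∉X : ∀ w → w ∉ X → (0<w : 0 < toℕ w) → parent w 0<w ∉ X
      parent∉X w w∉X 0<w with toℕ w ≟ k | toℕ w ≟ k₂
      ... | yes w≡k | _          = ≡.subst (_∉ X) (≡.sym (parent≡centre w 0<w (par-inner (≤-reflexive w≡k)))) c∉X
      ... | no _    | yes w≡k₂ = ≡.subst (_∉ X) (≡.sym (parent≡centre w 0<w (≡.trans (cong par w≡k₂) par-k₂))) c∉X
      ... | no w≢k  | no w≢k₂  = leaf-parent∉ w w∉X 0<w w≢k w≢k₂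

    centre∈X : centre ∈ X
    centre∈X with centre ∈? X
    ... | yes c∈X = c∈X
    ... | no c∉X with proj₁ rg
    ...   | u , v , u∉X , v∉X , ¬u⇝v =
      ⊥-elim (¬u⇝v (reach-trans (reach-centre c∉X u u∉X) (reach-sym (reach-centre c∉X v v∉X))))

    S₀⊆X : S₀ ⊆ X
    S₀⊆X {x} x∈S₀ with x ∈? X
    ... | yes x∈X = x∈X
    ... | no x∉X with toℕ x ≟ 0
    ...   | yes x≡0 = ≡.subst (_∈ X) (Fin.toℕ-injective (≡.trans toℕ-centre (≡.sym x≡0))) centre∈X
    ...   | no x≢0  = ⊥-elim (leaf-parent∉ x x∉X 0<x (<⇒≢ x<k) (<⇒≢ (<-trans x<k k<k₂))
                               (≡.subst (_∈ X) (≡.sym (parent≡centre x 0<x (par-inner (<⇒≤ x<k)))) centre∈X))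
      where
      x<k : toℕ x < k
      x<k = ∈below⇒< x∈S₀
      0<x : 0 < toℕ x
      0<x = n≢0⇒n>0 x≢0

  k≤n : k ≤ n
  k≤n = <⇒≤ (<-trans k<k₂ k₂<n)

  κ≡k : ExtraConnEq g tree k
  κ≡k = (S₀ , S₀-RgCutset , ∣below∣ k≤n) ,
        λ X rg → ≡.subst (_≤ ∣ X ∣) (∣below∣ k≤n) (p⊆q⇒∣p∣≤∣q∣ (S₀⊆X rg))

0<m≤o∸n⇒m+n≤o : ∀ {m n o} → 0 < m → m ≤ o ∸ n → m + n ≤ o
0<m≤o∸n⇒m+n≤o {m} {n} {o} 0<m m≤o∸n =
  m≤o∸n⇒m+n≤o m (<⇒≤ (m∸n≢0⇒n<m o∸n≢0)) m≤o∸n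
  where
  o∸n≢0 : o ∸ n ≢ 0
  o∸n≢0 o∸n≡0 = <⇒≱ 0<m (≤-trans m≤o∸n (≤-reflexive o∸n≡0))

proposition5p1 : (n g k : ℕ) → 1 ≤ g → g ≤ (n ∸ k ∸ 2) / 2 → 1 ≤ k → k ≤ n ∸ 2 * g ∸ 2 →
    (Σ (Graph n) λ G → Connected G × ExtraConnEq g G k × edgeCount G ≡ n ∸ 1) ×
    (∀ (G : Graph n) → Connected G → ExtraConnEq g G k → n ∸ 1 ≤ edgeCount G)
-- The bound on g is implied by the bound on k.
proposition5p1 n g k 1≤g _ 1≤k k≤n∸2g∸2 =
  (tree , tree-connected , κ≡k , tree-edgeCount) , λ G connected _ → connected⇒n∸1≤edgeCount G connected
  where
  room : (k + 2) + 2 * g ≤ n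
  room = 0<m≤o∸n⇒m+n≤o (≤-trans 1≤k (m≤m+n k 2)) (0<m≤o∸n⇒m+n≤o 1≤k k≤n∸2g∸2)
  open Extremal n g k 1≤g 1≤k room
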